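{- Let $w\in S_n$. Then \[\#\{(i,j,k): 1\leq i<j<k\leq n,\ w(i)<w(k)<w(j)\}=\sum_{(i,j)\in D(w)} r_w(i,j).\]
   Context: The Rothe diagram of $w\in S_n$ is $D(w):=\{(i,j):1\leq i,j\leq n,\ w(i)>j,\ w^{ -1}(j)>i\}$. The rank function is $r_w(i,j):=\#\{k:1\leq k\leq i,\ w(k)\leq j\}$. -}

module Defs where

open import Data.Nat using (ℕ; _+_)
open import Data.Fin using (Fin; _<_; _≤_; _<?_; _≤?_)
open import Data.Fin.Permutation using (Permutation′; _⟨$⟩ʳ_; _⟨$⟩ˡ_)
open import Data.List using (List; length; filter; allFin; cartesianProduct; map)
open import Data.Nat.ListAction using (sum)
open import Data.Product using (_×_; _,_)
open import Relation.Nullary.Decidable using (_×-dec_)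

-- Positions and values are 0-indexed via Fin n (index i here ↔ i+1 in the paper);
-- all conditions only compare positions/values with each other, so this is faithful.

triples : (n : ℕ) → List (Fin n × Fin n × Fin n)
triples n = cartesianProduct (allFin n) (cartesianProduct (allFin n) (allFin n))

count132 : {n : ℕ} → Permutation′ n → ℕ
count132 {n} w = length (filter P? (triples n))
  where
  P? : (t : Fin n × Fin n × Fin n) → _
  P? (i , j , k) = (i <? j) ×-dec ((j <? k) ×-dec (((w ⟨$⟩ʳ i) <? (w ⟨$⟩ʳ k)) ×-dec ((w ⟨$⟩ʳ k) <? (w ⟨$⟩ʳ j))))

rothe : {n : ℕ} → Permutation′ n → List (Fin n × Fin n)
rothe {n} w = filter D? (cartesianProduct (allFin n) (allFin n))
  where
  D? : (c : Fin n × Fin n) → _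
  D? (i , j) = (j <? (w ⟨$⟩ʳ i)) ×-dec (i <? (w ⟨$⟩ˡ j))

rank : {n : ℕ} → Permutation′ n → Fin n → Fin n → ℕ
rank {n} w i j = length (filter (λ k → (k ≤? i) ×-dec ((w ⟨$⟩ʳ k) ≤? j)) (allFin n))

rankSumOverDiagram : {n : ℕ} → Permutation′ n → ℕ
rankSumOverDiagram w = sum (map (λ { (i , j) → rank w i j }) (rothe w))

-- A 132-pattern of w is a triple k < i < c with w(k) < w(c) < w(i).  Fix the
-- middle position i and the last position c, and put j = w(c).  Then
--   * w(c) < w(i) and i < c = w⁻¹(j) say exactly that (i , j) ∈ D(w), and
--   * given that, k < i and w(k) < w(c) are equivalent to k ≤ i and w(k) ≤ j,
--     i.e. to k being counted by r_w(i , j).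
-- Hence the patterns with middle i and last value j are in bijection with the
-- positions counted by r_w(i , j) when (i , j) ∈ D(w), and there are none otherwise.
module Submission where

open import Defs
open import Data.Nat using (ℕ; zero; suc; _+_; _*_)
-- Orders on Fin n are those of toℕ, so the ℕ order lemmas apply to them directly.
import Data.Nat.Properties as ℕ
open import Data.Fin using (Fin; zero; suc; _<_; _≤_; _<?_; _≤?_)
import Data.Fin.Properties as Fin
open import Data.Fin.Permutation using (Permutation′; _⟨$⟩ʳ_; _⟨$⟩ˡ_; inverseˡ)
open import Data.List using (List; []; _∷_; length; filter; allFin; cartesianProduct; map; tabulate; _++_)
open import Data.List.Properties using (map-++; map-∘; map-tabulate)
open import Data.Nat.ListAction using () renaming (sum to listSum)
open import Data.Nat.ListAction.Properties using (sum-++)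
open import Data.Product using (_×_; _,_)
open import Data.Bool using (Bool; true; false)
open import Relation.Nullary using (Dec; yes; no; does; contradiction)
open import Relation.Nullary.Decidable using (_×-dec_)
open import Relation.Unary using (Pred; Decidable)
open import Relation.Binary.PropositionalEquality
open import Function using (_∘_; id)
open import Algebra.Properties.Semiring.Sum ℕ.+-*-semiring
  using (sum-syntax; sum-cong-≗; ∑-comm; ∑-permute; *-distribˡ-sum)

𝟙 : ∀ {p} {P : Set p} → Dec P → ℕ
𝟙 d = fromBool (does d)
  where
  fromBool : Bool → ℕ
  fromBool true  = 1
  fromBool false = 0

𝟙-× : ∀ {p q} {P : Set p} {Q : Set q} (a : Dec P) (b : Dec Q) → 𝟙 (a ×-dec b) ≡ 𝟙 a * 𝟙 b
𝟙-× (yes _) (yes _) = refl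
𝟙-× (yes _) (no _)  = refl
𝟙-× (no _)  (yes _) = refl
𝟙-× (no _)  (no _)  = refl

𝟙-⇔ : ∀ {p q} {P : Set p} {Q : Set q} → (P → Q) → (Q → P) → (a : Dec P) (b : Dec Q) → 𝟙 a ≡ 𝟙 b
𝟙-⇔ to from (yes _) (yes _) = refl
𝟙-⇔ to from (yes p) (no ¬q) = contradiction (to p) ¬q
𝟙-⇔ to from (no ¬p) (yes q) = contradiction (from q) ¬p
𝟙-⇔ to from (no _)  (no _)  = refl

module _ {a p} {A : Set a} {P : Pred A p} (P? : Decidable P) where

  length-filter≡sum-𝟙 : ∀ xs → length (filter P? xs) ≡ listSum (map (𝟙 ∘ P?) xs)
  length-filter≡sum-𝟙 [] = refl
  length-filter≡sum-𝟙 (x ∷ xs) with P? x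
  ... | yes _ = cong suc (length-filter≡sum-𝟙 xs)
  ... | no _  = length-filter≡sum-𝟙 xs

  sum-filter≡sum-𝟙* : ∀ (f : A → ℕ) xs →
    listSum (map f (filter P? xs)) ≡ listSum (map (λ x → 𝟙 (P? x) * f x) xs)
  sum-filter≡sum-𝟙* f [] = refl
  sum-filter≡sum-𝟙* f (x ∷ xs) with P? x
  ... | yes _ = cong₂ _+_ (sym (ℕ.+-identityʳ (f x))) (sum-filter≡sum-𝟙* f xs)
  ... | no _  = sum-filter≡sum-𝟙* f xs

sum-cartesianProduct : ∀ {a b} {A : Set a} {B : Set b} (g : A × B → ℕ) xs (ys : List B) →
  listSum (map g (cartesianProduct xs ys)) ≡ listSum (map (λ x → listSum (map (λ y → g (x , y)) ys)) xs)
sum-cartesianProduct g [] ys = refl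
sum-cartesianProduct g (x ∷ xs) ys = begin
  listSum (map g (map (x ,_) ys ++ cartesianProduct xs ys))
    ≡⟨ cong listSum (map-++ g (map (x ,_) ys) (cartesianProduct xs ys)) ⟩
  listSum (map g (map (x ,_) ys) ++ map g (cartesianProduct xs ys))
    ≡⟨ sum-++ (map g (map (x ,_) ys)) _ ⟩
  listSum (map g (map (x ,_) ys)) + listSum (map g (cartesianProduct xs ys))
    ≡⟨ cong₂ _+_ (cong listSum (sym (map-∘ ys))) (sum-cartesianProduct g xs ys) ⟩
  listSum (map (λ y → g (x , y)) ys) + listSum (map (λ x → listSum (map (λ y → g (x , y)) ys)) xs)
    ∎
  where open ≡-Reasoning

sum-tabulate : ∀ n (f : Fin n → ℕ) → listSum (tabulate f) ≡ ∑[ i < n ] f i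
sum-tabulate zero    f = refl
sum-tabulate (suc n) f = cong (f zero +_) (sum-tabulate n (f ∘ suc))

sum-allFin : ∀ n (g : Fin n → ℕ) → listSum (map g (allFin n)) ≡ ∑[ i < n ] g i
sum-allFin n g = trans (cong listSum (map-tabulate id g)) (sum-tabulate n g)

sum-pairs : ∀ n (h : Fin n × Fin n → ℕ) →
  listSum (map h (cartesianProduct (allFin n) (allFin n))) ≡ ∑[ a < n ] ∑[ b < n ] h (a , b)
sum-pairs n h = trans (sum-cartesianProduct h (allFin n) (allFin n))
                      (trans (sum-allFin n _) (sum-cong-≗ {n} λ a → sum-allFin n _))

sum-triples : ∀ n (h : Fin n × Fin n × Fin n → ℕ) →
  listSum (map h (triples n)) ≡ ∑[ a < n ] ∑[ b < n ] ∑[ c < n ] h (a , b , c)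
sum-triples n h = trans (sum-cartesianProduct h (allFin n) _)
                        (trans (sum-allFin n _) (sum-cong-≗ {n} λ a → sum-pairs n _))

module _ {n : ℕ} (w : Permutation′ n) where

  Is132 : Fin n → Fin n → Fin n → Set
  Is132 k i c = k < i × i < c × (w ⟨$⟩ʳ k) < (w ⟨$⟩ʳ c) × (w ⟨$⟩ʳ c) < (w ⟨$⟩ʳ i)

  InDiagram : Fin n → Fin n → Set
  InDiagram i j = j < (w ⟨$⟩ʳ i) × i < (w ⟨$⟩ˡ j)

  CountedBy : Fin n → Fin n → Fin n → Set
  CountedBy i j k = k ≤ i × (w ⟨$⟩ʳ k) ≤ j

  -- The decision procedures used in Defs for these three notions.
  is132? : ∀ k i c → Dec (Is132 k i c)
  is132? k i c = (k <? i) ×-dec ((i <? c) ×-dec (((w ⟨$⟩ʳ k) <? (w ⟨$⟩ʳ c)) ×-dec ((w ⟨$⟩ʳ c) <? (w ⟨$⟩ʳ i))))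

  inDiagram? : ∀ i j → Dec (InDiagram i j)
  inDiagram? i j = (j <? (w ⟨$⟩ʳ i)) ×-dec (i <? (w ⟨$⟩ˡ j))

  countedBy? : ∀ i j k → Dec (CountedBy i j k)
  countedBy? i j k = (k ≤? i) ×-dec ((w ⟨$⟩ʳ k) ≤? j)

  w-injective : ∀ {x y} → w ⟨$⟩ʳ x ≡ w ⟨$⟩ʳ y → x ≡ y
  w-injective {x} {y} wx≡wy = begin
    x                     ≡⟨ inverseˡ w ⟨
    w ⟨$⟩ˡ (w ⟨$⟩ʳ x)  ≡⟨ cong (w ⟨$⟩ˡ_) wx≡wy ⟩
    w ⟨$⟩ˡ (w ⟨$⟩ʳ y)  ≡⟨ inverseˡ w ⟩
    y                     ∎
    where open ≡-Reasoning

  pattern⇒cell : ∀ {k i c} → Is132 k i c → InDiagram i (w ⟨$⟩ʳ c) × CountedBy i (w ⟨$⟩ʳ c) k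
  pattern⇒cell {i = i} (k<i , i<c , wk<wc , wc<wi) =
    (wc<wi , subst (i <_) (sym (inverseˡ w)) i<c) , (ℕ.<⇒≤ k<i , ℕ.<⇒≤ wk<wc)

  cell⇒pattern : ∀ {k i c} → InDiagram i (w ⟨$⟩ʳ c) × CountedBy i (w ⟨$⟩ʳ c) k → Is132 k i c
  cell⇒pattern {k} {i} {c} ((wc<wi , i<w⁻¹wc) , (k≤i , wk≤wc)) = k<i , i<c , wk<wc , wc<wi
    where
    i<c : i < c
    i<c = subst (i <_) (inverseˡ w) i<w⁻¹wc
    -- k = i would force w(i) ≤ w(c) < w(i).
    k<i : k < i
    k<i = Fin.≤∧≢⇒< k≤i (λ { refl → ℕ.<⇒≱ wc<wi wk≤wc })
    -- w(k) = w(c) would force k = c, but k ≤ i < c.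
    wk<wc : (w ⟨$⟩ʳ k) < (w ⟨$⟩ʳ c)
    wk<wc = Fin.≤∧≢⇒< wk≤wc (Fin.<⇒≢ (ℕ.≤-<-trans k≤i i<c) ∘ w-injective)

  rank≡∑ : ∀ i j → rank w i j ≡ ∑[ k < n ] 𝟙 (countedBy? i j k)
  rank≡∑ i j = trans (length-filter≡sum-𝟙 (countedBy? i j) (allFin n)) (sum-allFin n _)

  patterns-through : ∀ i c →
    ∑[ k < n ] 𝟙 (is132? k i c) ≡ 𝟙 (inDiagram? i (w ⟨$⟩ʳ c)) * rank w i (w ⟨$⟩ʳ c)
  patterns-through i c = begin
    ∑[ k < n ] 𝟙 (is132? k i c)
      ≡⟨ sum-cong-≗ {n} (λ k → 𝟙-⇔ pattern⇒cell cell⇒pattern (is132? k i c) (inDiagram? i j ×-dec countedBy? i j k)) ⟩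
    ∑[ k < n ] 𝟙 (inDiagram? i j ×-dec countedBy? i j k)
      ≡⟨ sum-cong-≗ {n} (λ k → 𝟙-× (inDiagram? i j) (countedBy? i j k)) ⟩
    ∑[ k < n ] (𝟙 (inDiagram? i j) * 𝟙 (countedBy? i j k))
      ≡⟨ *-distribˡ-sum {n} (𝟙 (inDiagram? i j)) _ ⟨
    𝟙 (inDiagram? i j) * ∑[ k < n ] 𝟙 (countedBy? i j k)
      ≡⟨ cong (𝟙 (inDiagram? i j) *_) (rank≡∑ i j) ⟨
    𝟙 (inDiagram? i j) * rank w i j
      ∎
    where
    open ≡-Reasoning
    j = w ⟨$⟩ʳ c

  count132≡∑ : count132 w ≡ ∑[ k < n ] ∑[ i < n ] ∑[ c < n ] 𝟙 (is132? k i c)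
  count132≡∑ = trans (length-filter≡sum-𝟙 _ (triples n)) (sum-triples n _)

  rankSum≡∑ : rankSumOverDiagram w ≡ ∑[ i < n ] ∑[ j < n ] (𝟙 (inDiagram? i j) * rank w i j)
  rankSum≡∑ = trans (sum-filter≡sum-𝟙* _ _ (cartesianProduct (allFin n) (allFin n))) (sum-pairs n _)

lemma3p1 : (n : ℕ) (w : Permutation′ n) → count132 w ≡ rankSumOverDiagram w
lemma3p1 n w = begin
  count132 w
    ≡⟨ count132≡∑ w ⟩
  ∑[ k < n ] ∑[ i < n ] ∑[ c < n ] 𝟙 (is132? w k i c)
    ≡⟨ ∑-comm (λ k i → ∑[ c < n ] 𝟙 (is132? w k i c)) ⟩
  ∑[ i < n ] ∑[ k < n ] ∑[ c < n ] 𝟙 (is132? w k i c)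
    ≡⟨ sum-cong-≗ {n} (λ i → ∑-comm (λ k c → 𝟙 (is132? w k i c))) ⟩
  ∑[ i < n ] ∑[ c < n ] ∑[ k < n ] 𝟙 (is132? w k i c)
    ≡⟨ sum-cong-≗ {n} (λ i → sum-cong-≗ {n} (patterns-through w i)) ⟩
  ∑[ i < n ] ∑[ c < n ] (𝟙 (inDiagram? w i (w ⟨$⟩ʳ c)) * rank w i (w ⟨$⟩ʳ c))
    ≡⟨ sum-cong-≗ {n} (λ i → ∑-permute (λ j → 𝟙 (inDiagram? w i j) * rank w i j) w) ⟨
  ∑[ i < n ] ∑[ j < n ] (𝟙 (inDiagram? w i j) * rank w i j)
    ≡⟨ rankSum≡∑ w ⟨
  rankSumOverDiagram w
    ∎
  where open ≡-Reasoning
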